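{- On the set of topologies on a finite set $X$, the relation "$\mathcal T'$ is $\mathcal T$-admissible" is transitive: if $\mathcal T''$ is $\mathcal T'$-admissible and $\mathcal T'$ is $\mathcal T$-admissible, then $\mathcal T''$ is $\mathcal T$-admissible.
   Context: For a topology $\mathcal T$ on a finite set $X$, the associated quasi-order is $x\le_{\mathcal T}y$ iff every open set containing $x$ contains $y$; topologies correspond bijectively to quasi-orders, open sets being final segments. Write $x\sim_{\mathcal T}y$ iff $x\le_{\mathcal T}y$ and $y\le_{\mathcal T}x$. Write $\mathcal T'\prec\mathcal T$ when every $\mathcal T$-open set is $\mathcal T'$-open (equivalently $x\le_{\mathcal T'}y\Rightarrow x\le_{\mathcal T}y$). For $\mathcal T'\prec\mathcal T$, the quotient $\mathcal T/\mathcal T'$ is the topology on $X$ whose quasi-order is the transitive closure of $x\,\mathcal R\,y\iff(x\le_{\mathcal T}y\text{ or }y\le_{\mathcal T'}x)$. For $Y\subset X$, $\mathcal T|_Y=\{Z\cap Y:Z\in\mathcal T\}$, and $Y$ is $\mathcal T$-connected if $(Y,\mathcal T|_Y)$ is connected. $\mathcal T'$ is $\mathcal T$-admissible if $\mathcal T'\prec\mathcal T$, $\mathcal T'|_Y=\mathcal T|_Y$ for every $\mathcal T'$-connected $Y\subset X$, and $x\sim_{\mathcal T/\mathcal T'}y\iff x\sim_{\mathcal T'/\mathcal T'}y$ for all $x,y\in X$. -}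

module Defs where

open import Data.Nat using (ℕ)
open import Data.Bool using (Bool; true)
open import Data.Fin using (Fin)
open import Data.Fin.Subset using (Subset; _∈_; _∩_; _∪_; ⊥; ⊤; Nonempty)
open import Data.Product using (Σ; ∃; _×_)
open import Relation.Binary.PropositionalEquality using (_≡_)
open import Relation.Binary.Construct.Closure.Transitive using (TransClosure)
open import Relation.Nullary using (¬_)
open import Data.Sum using (_⊎_)
open import Function.Bundles using (_⇔_)

-- A topology on X is a set of subsets of X
-- (given by its Bool-valued membership test) containing ∅ and X and
-- closed under binary unions and intersections (equivalent to arbitrary
-- ones since X is finite).
record Topology (n : ℕ) : Set where
  field
    isOpen   : Subset n → Bool
    ∅-open   : isOpen ⊥ ≡ true
    X-open   : isOpen ⊤ ≡ true
    ∪-open   : ∀ U V → isOpen U ≡ true → isOpen V ≡ true → isOpen (U ∪ V) ≡ true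
    ∩-open   : ∀ U V → isOpen U ≡ true → isOpen V ≡ true → isOpen (U ∩ V) ≡ true

open Topology public

Open : ∀ {n} → Topology n → Subset n → Set
Open T U = isOpen T U ≡ true

_≤[_]_ : ∀ {n} → Fin n → Topology n → Fin n → Set
x ≤[ T ] y = ∀ U → Open T U → x ∈ U → y ∈ U

_∼[_]_ : ∀ {n} → Fin n → Topology n → Fin n → Set
x ∼[ T ] y = (x ≤[ T ] y) × (y ≤[ T ] x)

_≺_ : ∀ {n} → Topology n → Topology n → Set
T' ≺ T = ∀ U → Open T U → Open T' U

-- Quasi-order of the quotient T / T' (for T' ≺ T): the transitive closure
-- of  x R y  iff  (x ≤_T y  or  y ≤_T' x).
QuotRel : ∀ {n} → Topology n → Topology n → Fin n → Fin n → Set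
QuotRel T T' x y = (x ≤[ T ] y) ⊎ (y ≤[ T' ] x)

_≤Quot[_/_]_ : ∀ {n} → Fin n → Topology n → Topology n → Fin n → Set
x ≤Quot[ T / T' ] y = TransClosure (QuotRel T T') x y

_∼Quot[_/_]_ : ∀ {n} → Fin n → Topology n → Topology n → Fin n → Set
x ∼Quot[ T / T' ] y = (x ≤Quot[ T / T' ] y) × (y ≤Quot[ T / T' ] x)

OpenIn : ∀ {n} → Topology n → Subset n → Subset n → Set
OpenIn T Y W = ∃ λ Z → Open T Z × (W ≡ Z ∩ Y)

Connected : ∀ {n} → Topology n → Subset n → Set
Connected T Y = ¬ (Σ (Subset _) λ U → Σ (Subset _) λ V →
  OpenIn T Y U × OpenIn T Y V × (U ∩ V ≡ ⊥) × (U ∪ V ≡ Y) × Nonempty U × Nonempty V)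

SameRestriction : ∀ {n} → Topology n → Topology n → Subset n → Set
SameRestriction T' T Y = ∀ W → OpenIn T' Y W ⇔ OpenIn T Y W

Admissible : ∀ {n} → Topology n → Topology n → Set
Admissible T' T =
  (T' ≺ T)
  × (∀ Y → Connected T' Y → SameRestriction T' T Y)
  × (∀ x y → (x ∼Quot[ T / T' ] y) ⇔ (x ∼Quot[ T' / T' ] y))

-- The first two conditions of admissibility compose directly.  For the third, take a
-- cycle x →⁺ y →⁺ x in the quasi-order of T/T''.  Every point z on it is
-- T/T''-equivalent to x, hence T/T'-equivalent, hence T'/T'-equivalent
-- since T' is T-admissible; so the whole cycle lies in the T'-connected
-- component C of x.  There T and T' induce the same topology, so every
-- T-step of the cycle is a T'-step, the cycle lives in T'/T'', and
-- T''-admissibility of T' finishes.  As X is finite, C can be built as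
-- the intersection of all T'-clopen sets containing x.
module Submission where

open import Defs
open import Data.Nat using (ℕ; zero; suc)
open import Data.Bool using (true; if_then_else_)
import Data.Bool.Properties as Bool
open import Data.Vec using ([]; _∷_)
open import Data.Fin using (Fin)
open import Data.Fin.Subset
  using (Subset; _∈_; _∉_; _∩_; _∪_; ∁; ⊥; ⊤; inside; outside)
open import Data.Fin.Subset.Properties
  using (_∈?_; ∈⊤; ∉⊥; x∈p∩q⁺; x∈p∩q⁻; x∈p∪q⁺; x∈p∪q⁻; x∉p⇒x∈∁p; x∈∁p⇒x∉p;
         x∈p⇒x∉∁p; ⊆-antisym; ∩-comm; ∪-comm; ∪-∩-booleanAlgebra)
import Algebra.Lattice.Properties.BooleanAlgebra as BooleanAlgebraProperties
open import Data.Product using (_×_; _,_; proj₁; proj₂; uncurry)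
open import Data.Sum using (inj₁; inj₂)
import Data.Sum as Sum
open import Data.Empty using (⊥-elim)
open import Level using (Level)
open import Relation.Binary.Core using (Rel)
open import Relation.Binary.PropositionalEquality using (_≡_; refl; sym; trans; subst)
open import Relation.Binary.Construct.Closure.Transitive
  using (TransClosure; [_]; _∷_; _++_; _∷ʳ_)
open import Relation.Nullary using (yes; no; does)
open import Relation.Nullary.Decidable using (_×-dec_)
open import Relation.Unary using (Pred; Decidable)
open import Function using (_∘_)
open import Function.Bundles using (_⇔_; mk⇔; Equivalence)

open Equivalence

private
  variable
    a ℓ : Level
    A : Set a
    n : ℕ

∁-∩ : (p q : Subset n) → ∁ (p ∩ q) ≡ ∁ p ∪ ∁ q
∁-∩ {n} = BooleanAlgebraProperties.deMorgan₁ (∪-∩-booleanAlgebra n)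

∁⊤≡⊥ : ∁ (⊤ {n}) ≡ ⊥
∁⊤≡⊥ {n} = BooleanAlgebraProperties.¬⊤≈⊥ (∪-∩-booleanAlgebra n)

∁-part : {p q r : Subset n} → p ∩ q ≡ ⊥ → p ∪ q ≡ r → ∁ p ≡ ∁ r ∪ q
∁-part {p = p} {q} {r} disjoint cover = ⊆-antisym ⊆ ⊇
  where
  ⊆ : ∀ {w} → w ∈ ∁ p → w ∈ ∁ r ∪ q
  ⊆ {w} w∈∁p with w ∈? r
  ... | no w∉r = x∈p∪q⁺ (inj₁ (x∉p⇒x∈∁p w∉r))
  ... | yes w∈r with x∈p∪q⁻ p q (subst (w ∈_) (sym cover) w∈r)
  ...   | inj₁ w∈p = ⊥-elim (x∈∁p⇒x∉p w∈∁p w∈p)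
  ...   | inj₂ w∈q = x∈p∪q⁺ (inj₂ w∈q)
  ⊇ : ∀ {w} → w ∈ ∁ r ∪ q → w ∈ ∁ p
  ⊇ {w} w∈∁r∪q with w ∈? p | x∈p∪q⁻ (∁ r) q w∈∁r∪q
  ... | no w∉p | _        = x∉p⇒x∈∁p w∉p
  ... | yes w∈p | inj₁ w∈∁r =
    ⊥-elim (x∈∁p⇒x∉p w∈∁r (subst (w ∈_) cover (x∈p∪q⁺ (inj₁ w∈p))))
  ... | yes w∈p | inj₂ w∈q = ⊥-elim (∉⊥ (subst (w ∈_) disjoint (x∈p∩q⁺ (w∈p , w∈q))))

⋂-family : ∀ k → (Subset k → Subset n) → Subset n
⋂-family zero    f = f []
⋂-family (suc k) f = ⋂-family k (λ U → f (inside ∷ U)) ∩ ⋂-family k (λ U → f (outside ∷ U))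

module _ {n : ℕ} where

  ∈⋂-family⁺ : ∀ k {f : Subset k → Subset n} {w} → (∀ U → w ∈ f U) → w ∈ ⋂-family k f
  ∈⋂-family⁺ zero    w∈f = w∈f []
  ∈⋂-family⁺ (suc k) w∈f = x∈p∩q⁺ (∈⋂-family⁺ k (λ U → w∈f _) , ∈⋂-family⁺ k (λ U → w∈f _))

  ∈⋂-family⁻ : ∀ k {f : Subset k → Subset n} {w} → w ∈ ⋂-family k f → ∀ U → w ∈ f U
  ∈⋂-family⁻ zero    w∈⋂ []            = w∈⋂
  ∈⋂-family⁻ (suc k) w∈⋂ (inside  ∷ U) = ∈⋂-family⁻ k (proj₁ (x∈p∩q⁻ _ _ w∈⋂)) U
  ∈⋂-family⁻ (suc k) w∈⋂ (outside ∷ U) = ∈⋂-family⁻ k (proj₂ (x∈p∩q⁻ _ _ w∈⋂)) U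

  ⋂-family-preserves : (Q : Pred (Subset n) ℓ) → (∀ {U V} → Q U → Q V → Q (U ∩ V)) →
                       ∀ k {f : Subset k → Subset n} → (∀ U → Q (f U)) → Q (⋂-family k f)
  ⋂-family-preserves Q ∩-closed zero    Qf = Qf []
  ⋂-family-preserves Q ∩-closed (suc k) Qf =
    ∩-closed (⋂-family-preserves Q ∩-closed k (λ U → Qf _))
             (⋂-family-preserves Q ∩-closed k (λ U → Qf _))

  module _ {P : Pred (Subset n) ℓ} (P? : Decidable P) where

    ⋂[_] : Subset n
    ⋂[_] = ⋂-family n (λ U → if does (P? U) then U else ⊤)

    ∈⋂⁺ : ∀ {w} → (∀ U → P U → w ∈ U) → w ∈ ⋂[_]
    ∈⋂⁺ {w} w∈P = ∈⋂-family⁺ n w∈member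
      where
      w∈member : ∀ U → w ∈ (if does (P? U) then U else ⊤)
      w∈member U with P? U
      ... | yes PU = w∈P U PU
      ... | no  _  = ∈⊤

    ∈⋂⁻ : ∀ {w} → w ∈ ⋂[_] → ∀ U → P U → w ∈ U
    ∈⋂⁻ w∈⋂ U PU with P? U | ∈⋂-family⁻ n w∈⋂ U
    ... | yes _  | w∈U = w∈U
    ... | no ¬PU | _   = ⊥-elim (¬PU PU)

    ⋂-preserves : (Q : Pred (Subset n) ℓ) → Q ⊤ → (∀ {U V} → Q U → Q V → Q (U ∩ V)) →
                  (∀ {U} → P U → Q U) → Q ⋂[_]
    ⋂-preserves Q Q⊤ ∩-closed P⇒Q = ⋂-family-preserves Q ∩-closed n Q-member
      where
      Q-member : ∀ U → Q (if does (P? U) then U else ⊤)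
      Q-member U with P? U
      ... | yes PU = P⇒Q PU
      ... | no  _  = Q⊤

module _ {R S : Rel A ℓ} where

  private
    _R⁺_ = TransClosure R
    _S⁺_ = TransClosure S

  map⁺ : (∀ {x y} → R x y → S x y) → ∀ {x y} → x R⁺ y → x S⁺ y
  map⁺ R⇒S [ r ]    = [ R⇒S r ]
  map⁺ R⇒S (r ∷ rs) = R⇒S r ∷ map⁺ R⇒S rs

  map⁺-onCycle : ∀ {x} →
    (∀ {y z} → x R⁺ y × y R⁺ x → x R⁺ z × z R⁺ x → R y z → S y z) →
    ∀ {y z} → x R⁺ y → y R⁺ z → z R⁺ x → y S⁺ z
  map⁺-onCycle R⇒S xy [ r ] zx = [ R⇒S (xy , r ∷ zx) (xy ∷ʳ r , zx) r ]
  map⁺-onCycle R⇒S xy (r ∷ rs) zx =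
    R⇒S (xy , r ∷ rs ++ zx) (xy ∷ʳ r , rs ++ zx) r ∷ map⁺-onCycle R⇒S (xy ∷ʳ r) rs zx

≺-refl : {T : Topology n} → T ≺ T
≺-refl U U-open = U-open

≺-trans : {T T' T'' : Topology n} → T'' ≺ T' → T' ≺ T → T'' ≺ T
≺-trans T''≺T' T'≺T U U-open = T''≺T' U (T'≺T U U-open)

≺⇒≤ : {T' T : Topology n} → T' ≺ T → ∀ {x y} → x ≤[ T' ] y → x ≤[ T ] y
≺⇒≤ T'≺T x≤y U U-open = x≤y U (T'≺T U U-open)

≤Quot-mono : {T₁ T₁' T₂ T₂' : Topology n} → T₁ ≺ T₂ → T₁' ≺ T₂' →
             ∀ {x y} → x ≤Quot[ T₁ / T₁' ] y → x ≤Quot[ T₂ / T₂' ] y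
≤Quot-mono {T₁ = T₁} {T₁'} {T₂} {T₂'} T₁≺T₂ T₁'≺T₂' =
  map⁺ (Sum.map (≺⇒≤ {T' = T₁} {T₂} T₁≺T₂) (≺⇒≤ {T' = T₁'} {T₂'} T₁'≺T₂'))

sameRestriction⇒≤ : {T' T : Topology n} {Y : Subset n} → SameRestriction T' T Y →
                    ∀ {x y} → x ∈ Y → y ∈ Y → x ≤[ T ] y → x ≤[ T' ] y
sameRestriction⇒≤ {Y = Y} same {x} {y} x∈Y y∈Y x≤y U U-open x∈U
  with to (same (U ∩ Y)) (U , U-open , refl)
... | Z , Z-open , U∩Y≡Z∩Y = proj₁ (x∈p∩q⁻ U Y y∈U∩Y)
  where
  x∈Z : x ∈ Z
  x∈Z = proj₁ (x∈p∩q⁻ Z Y (subst (x ∈_) U∩Y≡Z∩Y (x∈p∩q⁺ (x∈U , x∈Y))))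
  y∈U∩Y : y ∈ U ∩ Y
  y∈U∩Y = subst (y ∈_) (sym U∩Y≡Z∩Y) (x∈p∩q⁺ (x≤y Z Z-open x∈Z , y∈Y))

module _ (T : Topology n) where

  Clopen : Subset n → Set
  Clopen U = Open T U × Open T (∁ U)

  clopen? : Decidable Clopen
  clopen? U = (isOpen T U Bool.≟ true) ×-dec (isOpen T (∁ U) Bool.≟ true)

  clopen-⊤ : Clopen ⊤
  clopen-⊤ = X-open T , subst (Open T) (sym ∁⊤≡⊥) (∅-open T)

  clopen-∩ : ∀ {U V} → Clopen U → Clopen V → Clopen (U ∩ V)
  clopen-∩ {U} {V} (U-open , ∁U-open) (V-open , ∁V-open) =
    ∩-open T U V U-open V-open ,
    subst (Open T) (sym (∁-∩ U V)) (∪-open T _ _ ∁U-open ∁V-open)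

  openIn⇒open : ∀ {Y W} → Open T Y → OpenIn T Y W → Open T W
  openIn⇒open Y-open (Z , Z-open , W≡Z∩Y) =
    subst (Open T) (sym W≡Z∩Y) (∩-open T _ _ Z-open Y-open)

  clopen-upward : ∀ {U} → Clopen U → ∀ {x y} → x ≤Quot[ T / T ] y → x ∈ U → y ∈ U
  clopen-upward {U} U-clopen = go
    where
    step : ∀ {x y} → QuotRel T T x y → x ∈ U → y ∈ U
    step (inj₁ x≤y) x∈U = x≤y U (proj₁ U-clopen) x∈U
    step {y = y} (inj₂ y≤x) x∈U with y ∈? U
    ... | yes y∈U = y∈U
    ... | no  y∉U = ⊥-elim (x∈p⇒x∉∁p x∈U (y≤x (∁ U) (proj₂ U-clopen) (x∉p⇒x∈∁p y∉U)))
    go : ∀ {x y} → x ≤Quot[ T / T ] y → x ∈ U → y ∈ U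
    go [ r ]    = step r
    go (r ∷ rs) = go rs ∘ step r

  ClopenNbhd : Fin n → Subset n → Set
  ClopenNbhd x U = Clopen U × x ∈ U

  clopenNbhd? : ∀ x → Decidable (ClopenNbhd x)
  clopenNbhd? x U = clopen? U ×-dec x ∈? U

  component : Fin n → Subset n
  component x = ⋂[ clopenNbhd? x ]

  component-clopen : ∀ x → Clopen (component x)
  component-clopen x = ⋂-preserves (clopenNbhd? x) Clopen clopen-⊤ clopen-∩ proj₁

  ∈component⁺ : ∀ {x y} → (∀ U → Clopen U → x ∈ U → y ∈ U) → y ∈ component x
  ∈component⁺ {x} y∈U = ∈⋂⁺ (clopenNbhd? x) (λ U → uncurry (y∈U U))

  ∈component⁻ : ∀ {x y} → y ∈ component x → ∀ U → Clopen U → x ∈ U → y ∈ U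
  ∈component⁻ {x} y∈C U U-clopen x∈U = ∈⋂⁻ (clopenNbhd? x) y∈C U (U-clopen , x∈U)

  x∈component : ∀ x → x ∈ component x
  x∈component x = ∈component⁺ (λ U _ x∈U → x∈U)

  ≤Quot⇒∈component : ∀ {x y} → x ≤Quot[ T / T ] y → y ∈ component x
  ≤Quot⇒∈component x≤y = ∈component⁺ (λ U U-clopen → clopen-upward U-clopen x≤y)

  -- U is T-clopen (its complement is ∁ (component x) ∪ V), so it contains component x.
  component-piece : ∀ x {U V} → OpenIn T (component x) U → OpenIn T (component x) V →
                    U ∩ V ≡ ⊥ → U ∪ V ≡ component x → x ∈ U → ∀ {v} → v ∉ V
  component-piece x {U} {V} U-openIn V-openIn disjoint cover x∈U {v} v∈V =
    ∉⊥ (subst (v ∈_) disjoint (x∈p∩q⁺ (v∈U , v∈V)))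
    where
    C-open = proj₁ (component-clopen x)
    U-clopen : Clopen U
    U-clopen = openIn⇒open C-open U-openIn ,
      subst (Open T) (sym (∁-part disjoint cover))
        (∪-open T _ _ (proj₂ (component-clopen x)) (openIn⇒open C-open V-openIn))
    v∈U : v ∈ U
    v∈U = ∈component⁻ (subst (v ∈_) cover (x∈p∪q⁺ (inj₂ v∈V))) U U-clopen x∈U

  component-connected : ∀ x → Connected T (component x)
  component-connected x (U , V , U-openIn , V-openIn , disjoint , cover , (u , u∈U) , (v , v∈V))
    with x∈p∪q⁻ U V (subst (x ∈_) (sym cover) (x∈component x))
  ... | inj₁ x∈U = component-piece x U-openIn V-openIn disjoint cover x∈U v∈V
  ... | inj₂ x∈V = component-piece x V-openIn U-openIn
                     (trans (∩-comm V U) disjoint) (trans (∪-comm V U) cover) x∈V u∈U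

module Transitivity (T T' T'' : Topology n)
  (T''-adm : Admissible T'' T') (T'-adm : Admissible T' T) where

  private
    T''≺T'      = proj₁ T''-adm
    T'≺T        = proj₁ T'-adm
    connected'' = proj₁ (proj₂ T''-adm)
    connected'  = proj₁ (proj₂ T'-adm)
    ∼Quot''     = proj₂ (proj₂ T''-adm)
    ∼Quot'      = proj₂ (proj₂ T'-adm)

  T''≺T : T'' ≺ T
  T''≺T = ≺-trans {T = T} {T'} {T''} T''≺T' T'≺T

  admissible-sameRestriction : ∀ Y → Connected T'' Y → SameRestriction T'' T Y
  admissible-sameRestriction Y Y-connected W =
    mk⇔ (to (same' W) ∘ to (same'' W)) (from (same'' W) ∘ from (same' W))
    where
    same'' = connected'' Y Y-connected
    Y-connected' : Connected T' Y
    Y-connected' (U , V , U-openIn , V-openIn , rest) =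
      Y-connected (U , V , from (same'' U) U-openIn , from (same'' V) V-openIn , rest)
    same' = connected' Y Y-connected'

  weaken : ∀ {y z} → y ≤Quot[ T / T'' ] z → y ≤Quot[ T / T' ] z
  weaken = ≤Quot-mono {T₁ = T} {T''} {T} {T'} (≺-refl {T = T}) T''≺T'

  module _ {x : Fin n} where

    cycle⇒∈component : ∀ {z} → x ≤Quot[ T / T'' ] z × z ≤Quot[ T / T'' ] x →
                       z ∈ component T' x
    cycle⇒∈component (x≤z , z≤x) =
      ≤Quot⇒∈component T' (proj₁ (to (∼Quot' x _) (weaken x≤z , weaken z≤x)))

    QuotRel-onCycle : ∀ {y z} →
      x ≤Quot[ T / T'' ] y × y ≤Quot[ T / T'' ] x →
      x ≤Quot[ T / T'' ] z × z ≤Quot[ T / T'' ] x →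
      QuotRel T T'' y z → QuotRel T' T'' y z
    QuotRel-onCycle y-onCycle z-onCycle (inj₁ y≤z) =
      inj₁ (sameRestriction⇒≤ {T' = T'} {T}
        (connected' (component T' x) (component-connected T' x))
        (cycle⇒∈component y-onCycle) (cycle⇒∈component z-onCycle) y≤z)
    QuotRel-onCycle _ _ (inj₂ z≤y) = inj₂ z≤y

  admissible-∼Quot : ∀ x y → (x ∼Quot[ T / T'' ] y) ⇔ (x ∼Quot[ T'' / T'' ] y)
  admissible-∼Quot x y = mk⇔
    (λ (x≤y , y≤x) → to (∼Quot'' x y)
      ( map⁺-onCycle QuotRel-onCycle (x≤y ++ y≤x) x≤y y≤x
      , map⁺-onCycle QuotRel-onCycle x≤y y≤x (x≤y ++ y≤x)))
    (λ (x≤y , y≤x) → strengthen x≤y , strengthen y≤x)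
    where
    strengthen : ∀ {y z} → y ≤Quot[ T'' / T'' ] z → y ≤Quot[ T / T'' ] z
    strengthen = ≤Quot-mono {T₁ = T''} {T''} {T} {T''} T''≺T (≺-refl {T = T''})

proposition2p5 : ∀ (n : ℕ) (T T' T'' : Topology n) →
    Admissible T'' T' → Admissible T' T → Admissible T'' T
proposition2p5 n T T' T'' T''-adm T'-adm =
  T''≺T , admissible-sameRestriction , admissible-∼Quot
  where open Transitivity T T' T'' T''-adm T'-adm
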